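{- Let $G$ be a graph and $H$ a triangle-free subgraph of $G$ such that every maximal clique of $H$ is a maximal clique of $G$. Then $p(G)\ge p(H)$.
   Context: Graphs are finite and simple. For an acyclic digraph $D$, $P(D)$ is the graph on $V(D)$ with $uv$ an edge iff $(u,v)\in A(D)$ or $(v,u)\in A(D)$ or $u,v$ have a common out-neighbor in $D$. A phylogeny digraph for $G$ is an acyclic digraph $D$ with $G$ an induced subgraph of $P(D)$ and no arcs from $V(D)\setminus V(G)$ to $V(G)$; the phylogeny number $p(G)$ is the minimum of $|V(D)\setminus V(G)|$ over such $D$. -}

module Defs where

open import Data.Nat using (ℕ; _+_; _≤_)
open import Data.Fin using (Fin; _↑ˡ_; _↑ʳ_)
open import Data.Bool using (Bool; true; false)
open import Data.Product using (Σ; _×_; ∃; ∃-syntax)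
open import Data.Sum using (_⊎_)
open import Relation.Nullary using (¬_)
open import Relation.Unary using (Pred; _∈_; _⊆_)
open import Relation.Binary.PropositionalEquality using (_≡_; _≢_)
open import Relation.Binary.Construct.Closure.Transitive using (TransClosure)
open import Function.Definitions using (Injective)
open import Level using (0ℓ)

record Graph (n : ℕ) : Set where
  field
    adj    : Fin n → Fin n → Bool
    sym    : ∀ u v → adj u v ≡ adj v u
    irrefl : ∀ u → adj u u ≡ false
open Graph public

Adj : ∀ {n} → Graph n → Fin n → Fin n → Set
Adj G u v = adj G u v ≡ true

Digraph : ℕ → Set
Digraph N = Fin N → Fin N → Bool

Arc : ∀ {N} → Digraph N → Fin N → Fin N → Set
Arc D u v = D u v ≡ true

Acyclic : ∀ {N} → Digraph N → Set
Acyclic D = ∀ v → ¬ TransClosure (Arc D) v v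

PAdj : ∀ {N} → Digraph N → Fin N → Fin N → Set
PAdj D u v = u ≢ v × (Arc D u v ⊎ Arc D v u ⊎ ∃[ w ] (Arc D u w × Arc D v w))

-- D on Fin (n + k) is a phylogeny digraph for G, where V(G) is identified with
-- the first n vertices (u ↑ˡ k) and the k extra vertices are raise n.
IsPhylogenyDigraph : ∀ {n} (G : Graph n) (k : ℕ) → Digraph (n + k) → Set
IsPhylogenyDigraph {n} G k D =
  Acyclic D
  × (∀ (u v : Fin n) → (Adj G u v → PAdj D (u ↑ˡ k) (v ↑ˡ k))
                     × (PAdj D (u ↑ˡ k) (v ↑ˡ k) → Adj G u v))
  × (∀ (x : Fin k) (u : Fin n) → ¬ Arc D (n ↑ʳ x) (u ↑ˡ k))

HasPhylogenyDigraph : ∀ {n} → Graph n → ℕ → Set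
HasPhylogenyDigraph G k = Σ (Digraph _) (IsPhylogenyDigraph G k)

-- p(G) ≥ p(H), unfolding the minimum: whenever G has a phylogeny digraph
-- with k extra vertices, H has one with at most k extra vertices.
PhyloNumberGE : ∀ {n m} → Graph n → Graph m → Set
PhyloNumberGE G H = ∀ k → HasPhylogenyDigraph G k → ∃[ k' ] (k' ≤ k × HasPhylogenyDigraph H k')

IsClique : ∀ {n} → Graph n → Pred (Fin n) 0ℓ → Set
IsClique G S = ∀ u v → u ∈ S → v ∈ S → u ≢ v → Adj G u v

IsMaximalClique : ∀ {n} → Graph n → Pred (Fin n) 0ℓ → Set₁
IsMaximalClique G S = IsClique G S × (∀ (T : Pred _ 0ℓ) → IsClique G T → S ⊆ T → T ⊆ S)

TriangleFree : ∀ {n} → Graph n → Set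
TriangleFree G = ∀ u v w → ¬ (Adj G u v × Adj G v w × Adj G u w)

IsSubgraphVia : ∀ {m n} → Graph m → Graph n → (Fin m → Fin n) → Set
IsSubgraphVia H G φ = Injective _≡_ _≡_ φ × (∀ u v → Adj H u v → Adj G (φ u) (φ v))

image : ∀ {m n} → (Fin m → Fin n) → Pred (Fin m) 0ℓ → Pred (Fin n) 0ℓ
image φ S x = ∃[ u ] (u ∈ S × φ u ≡ x)

module Submission where

-- Let H be a triangle-free subgraph of G (via an injection φ) whose maximal
-- cliques stay maximal in G, and let D be a phylogeny digraph for G with k
-- extra vertices.  We build a phylogeny digraph D' for H with the same k extra
-- vertices.  Its arcs are
--   * u → v  for an edge uv of H with φu → φv in D, and
--   * u → x  for an extra vertex x with φu → x in D, provided some H-neighbour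
--            a of u also has φa → x in D.
-- The whole argument rests on one fact (`edge-closed`): for an edge uv of H
-- the pair {u, v} is a maximal clique of H (triangle-freeness), hence
-- {φu, φv} is a maximal clique of G, so no third vertex of G is adjacent to
-- both φu and φv.  Consequently the common out-neighbour in D of the ends of
-- an edge of H is an extra vertex, which gives the forward direction, and a
-- vertex v sharing an out-neighbour with u in D' must be a neighbour of u,
-- which gives the backward direction.  D' maps arc-preservingly into D, so it
-- is acyclic.

open import Defs hiding (sym; irrefl)
open import Data.Nat using (_+_)
open import Data.Nat.Properties using (≤-refl)
open import Data.Fin using (Fin; _↑ˡ_; splitAt; join; _≟_)
open import Data.Fin.Properties using (splitAt-join; join-splitAt; ↑ˡ-injective; any?)
open import Data.Bool using (true)
import Data.Bool as Bool
open import Data.Product using (_×_; _,_; proj₁; proj₂; ∃-syntax; uncurry)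
open import Data.Sum using (_⊎_; inj₁; inj₂)
import Data.Sum as Sum
open import Data.Empty using (⊥-elim)
open import Function.Base using (_∘_)
open import Function.Bundles using (Equivalence)
open import Relation.Nullary using (¬_; Dec; yes; no; does; contradiction)
open import Relation.Nullary.Decidable using (dec-true; map′; _×-dec_)
open import Relation.Unary using (Pred; _∈_; _⊆_; _∪_; ｛_｝)
open import Relation.Binary using (Rel; Decidable)
open import Relation.Binary.PropositionalEquality using (_≡_; _≢_; refl; sym; trans; cong; subst; subst₂)
open import Relation.Binary.Construct.Closure.Transitive using ([_]; equivalent; map)
open import Level using (0ℓ)

Linked : ∀ {A : Set} → Rel A 0ℓ → Rel A 0ℓ
Linked R x y = R x y ⊎ R y x ⊎ ∃[ w ] (R x w × R y w)

Linked-map : ∀ {A B : Set} {R : Rel A 0ℓ} {S : Rel B 0ℓ} (f : A → B)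
  → (∀ {x y} → R x y → S (f x) (f y)) → ∀ {x y} → Linked R x y → Linked S (f x) (f y)
Linked-map f preserve (inj₁ r)                 = inj₁ (preserve r)
Linked-map f preserve (inj₂ (inj₁ r))          = inj₂ (inj₁ (preserve r))
Linked-map f preserve (inj₂ (inj₂ (w , r , s))) = inj₂ (inj₂ (f w , preserve r , preserve s))

Adj-sym : ∀ {n} (G : Graph n) {u v : Fin n} → Adj G u v → Adj G v u
Adj-sym G {u} {v} e = trans (Graph.sym G v u) e

Adj-irrefl : ∀ {n} (G : Graph n) {u : Fin n} → ¬ Adj G u u
Adj-irrefl G {u} e with trans (sym (Graph.irrefl G u)) e
... | ()

Adj? : ∀ {n} (G : Graph n) → Decidable (Adj G)
Adj? G u v = adj G u v Bool.≟ true

Arc? : ∀ {N} (D : Digraph N) → Decidable (Arc D)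
Arc? D u v = D u v Bool.≟ true

Pair : ∀ {n} → Fin n → Fin n → Pred (Fin n) 0ℓ
Pair u v z = z ≡ u ⊎ z ≡ v

maximal-absorbs : ∀ {n} (G : Graph n) {S : Pred (Fin n) 0ℓ} {g : Fin n}
  → IsMaximalClique G S → (∀ {s} → s ∈ S → s ≢ g → Adj G s g) → g ∈ S
maximal-absorbs G {S} {g} (clique , maximal) adjacent =
  maximal (S ∪ ｛ g ｝) extended inj₁ (inj₂ refl)
  where
  extended : IsClique G (S ∪ ｛ g ｝)
  extended s t (inj₁ s∈S) (inj₁ t∈S) s≢t = clique s t s∈S t∈S s≢t
  extended s _ (inj₁ s∈S) (inj₂ refl) s≢g = adjacent s∈S s≢g
  extended _ t (inj₂ refl) (inj₁ t∈S) g≢t = Adj-sym G (adjacent t∈S (λ t≡g → g≢t (sym t≡g)))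
  extended _ _ (inj₂ refl) (inj₂ refl) g≢g = contradiction refl g≢g

edge-maximal : ∀ {m} (H : Graph m) → TriangleFree H
  → ∀ {u v} → Adj H u v → IsMaximalClique H (Pair u v)
edge-maximal H triangle-free {u} {v} e = clique , maximal
  where
  clique : IsClique H (Pair u v)
  clique _ _ (inj₁ refl) (inj₁ refl) ne = contradiction refl ne
  clique _ _ (inj₁ refl) (inj₂ refl) _  = e
  clique _ _ (inj₂ refl) (inj₁ refl) _  = Adj-sym H e
  clique _ _ (inj₂ refl) (inj₂ refl) ne = contradiction refl ne

  -- A third member t of a clique containing u and v would span a triangle.
  maximal : ∀ T → IsClique H T → Pair u v ⊆ T → T ⊆ Pair u v
  maximal T clique-T pair⊆T {t} t∈T with t ≟ u | t ≟ v
  ... | yes t≡u | _       = inj₁ t≡u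
  ... | no _    | yes t≡v = inj₂ t≡v
  ... | no t≢u  | no t≢v  = ⊥-elim (triangle-free u v t
        (e , Adj-sym H (clique-T t v t∈T (pair⊆T (inj₂ refl)) t≢v)
           , Adj-sym H (clique-T t u t∈T (pair⊆T (inj₁ refl)) t≢u)))

module PhylogenyFacts {n k} (G : Graph n) (D : Digraph (n + k))
  (phylogeny : IsPhylogenyDigraph G k D) where

  private
    ↑-injective : ∀ {g h : Fin n} → g ↑ˡ k ≡ h ↑ˡ k → g ≡ h
    ↑-injective {g} {h} = ↑ˡ-injective k g h

  adj⇒padj : ∀ {g h} → Adj G g h → PAdj D (g ↑ˡ k) (h ↑ˡ k)
  adj⇒padj {g} {h} = proj₁ (proj₁ (proj₂ phylogeny) g h)

  padj⇒adj : ∀ {g h} → PAdj D (g ↑ˡ k) (h ↑ˡ k) → Adj G g h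
  padj⇒adj {g} {h} = proj₂ (proj₁ (proj₂ phylogeny) g h)

  arc-irrefl : ∀ {x y} → Arc D x y → x ≢ y
  arc-irrefl a refl = proj₁ phylogeny _ [ a ]

  arc⇒adj : ∀ {g h} → Arc D (g ↑ˡ k) (h ↑ˡ k) → Adj G g h
  arc⇒adj a = padj⇒adj (arc-irrefl a , inj₁ a)

  common⇒adj : ∀ {g h w} → g ≢ h → Arc D (g ↑ˡ k) w → Arc D (h ↑ˡ k) w → Adj G g h
  common⇒adj {w = w} g≢h a b = padj⇒adj ((λ eq → g≢h (↑-injective eq)) , inj₂ (inj₂ (w , a , b)))

acyclic-reflect : ∀ {N M} (D : Digraph N) (E : Digraph M) (f : Fin N → Fin M)
  → (∀ {i j} → Arc D i j → Arc E (f i) (f j)) → Acyclic E → Acyclic D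
acyclic-reflect D E f preserve acyclic v cycle =
  acyclic (f v) (Equivalence.to equivalent (map preserve (Equivalence.from equivalent cycle)))

module Glued {m k} (R : Rel (Fin m ⊎ Fin k) 0ℓ) (R? : Decidable R) where

  glued : Digraph (m + k)
  glued i j = does (R? (splitAt m i) (splitAt m j))

  arc⇒R : ∀ {i j} → Arc glued i j → R (splitAt m i) (splitAt m j)
  arc⇒R {i} {j} = witness (R? (splitAt m i) (splitAt m j))
    where
    witness : ∀ {A : Set} (a? : Dec A) → does a? ≡ true → A
    witness (yes a) _ = a

  arc-from : ∀ {a j} → Arc glued (join m k a) j → R a (splitAt m j)
  arc-from {a} arc = subst (λ s → R s _) (splitAt-join m k a) (arc⇒R arc)

  R⇒arc-join : ∀ {a b} → R a b → Arc glued (join m k a) (join m k b)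
  R⇒arc-join {a} {b} r
    rewrite splitAt-join m k a | splitAt-join m k b = dec-true (R? a b) r

  PAdjR : Fin m → Fin m → Set
  PAdjR u v = u ≢ v × Linked R (inj₁ u) (inj₁ v)

  padj⇒PAdjR : ∀ u v → PAdj glued (u ↑ˡ k) (v ↑ˡ k) → PAdjR u v
  padj⇒PAdjR u v (ne , linked) =
      (λ u≡v → ne (cong (_↑ˡ k) u≡v))
    , subst₂ (Linked R) (splitAt-join m k (inj₁ u)) (splitAt-join m k (inj₁ v))
             (Linked-map {R = Arc glued} {S = R} (splitAt m) arc⇒R linked)

  PAdjR⇒padj : ∀ u v → PAdjR u v → PAdj glued (u ↑ˡ k) (v ↑ˡ k)
  PAdjR⇒padj u v (ne , linked) =
      (λ eq → ne (↑ˡ-injective k u v eq))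
    , Linked-map {R = R} {S = Arc glued} (join m k) R⇒arc-join linked

  glued-phylogeny : ∀ {N} (H : Graph m) (E : Digraph N) (f : Fin m ⊎ Fin k → Fin N)
    → (∀ {a b} → R a b → Arc E (f a) (f b)) → Acyclic E
    → (∀ u v → Adj H u v → PAdjR u v) → (∀ u v → PAdjR u v → Adj H u v)
    → (∀ x b → ¬ R (inj₂ x) b)
    → IsPhylogenyDigraph H k glued
  glued-phylogeny H E f preserve acyclic adj⇒ ⇒adj sink =
      acyclic-reflect glued E (f ∘ splitAt m) (λ arc → preserve (arc⇒R arc)) acyclic
    , (λ u v → (λ e → PAdjR⇒padj u v (adj⇒ u v e)) , (λ p → ⇒adj u v (padj⇒PAdjR u v p)))
    , (λ x u arc → sink x _ (arc-from arc))

module Restriction {n m} (G : Graph n) (H : Graph m) (φ : Fin m → Fin n)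
  (subgraph : IsSubgraphVia H G φ) (triangle-free : TriangleFree H)
  (maximal-preserved : ∀ (S : Pred (Fin m) 0ℓ) → IsMaximalClique H S → IsMaximalClique G (image φ S))
  where

  -- The key fact: {φu, φv} is a maximal clique of G for every edge uv of H,
  -- so a vertex of G adjacent to both φu and φv is one of them.
  edge-closed : ∀ {u v g} → Adj H u v
    → (φ u ≢ g → Adj G (φ u) g) → (φ v ≢ g → Adj G (φ v) g) → g ≡ φ u ⊎ g ≡ φ v
  edge-closed {u} {v} {g} e adj-u adj-v
    with maximal-absorbs G (maximal-preserved (Pair u v) (edge-maximal H triangle-free e)) adjacent
    where
    adjacent : ∀ {s} → s ∈ image φ (Pair u v) → s ≢ g → Adj G s g
    adjacent (_ , inj₁ refl , refl) = adj-u
    adjacent (_ , inj₂ refl , refl) = adj-v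
  ... | _ , inj₁ refl , refl = inj₁ refl
  ... | _ , inj₂ refl , refl = inj₂ refl

  edge-closed-H : ∀ {u v w} → Adj H u v
    → (φ u ≢ φ w → Adj G (φ u) (φ w)) → (φ v ≢ φ w → Adj G (φ v) (φ w)) → w ≡ u ⊎ w ≡ v
  edge-closed-H e adj-u adj-v =
    Sum.map (proj₁ subgraph) (proj₁ subgraph) (edge-closed e adj-u adj-v)

  module _ {k} (D : Digraph (n + k)) (phylogeny : IsPhylogenyDigraph G k D) where
    open PhylogenyFacts G D phylogeny

    embed : Fin m ⊎ Fin k → Fin (n + k)
    embed = join n k ∘ Sum.map₁ φ

    data RArc : Rel (Fin m ⊎ Fin k) 0ℓ where
      inner : ∀ {u v} → Adj H u v → Arc D (embed (inj₁ u)) (embed (inj₁ v))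
            → RArc (inj₁ u) (inj₁ v)
      outer : ∀ {u x} a → Arc D (embed (inj₁ u)) (embed (inj₂ x))
            → Adj H u a → Arc D (embed (inj₁ a)) (embed (inj₂ x))
            → RArc (inj₁ u) (inj₂ x)

    RArc? : Decidable RArc
    RArc? (inj₁ u) (inj₁ v) =
      map′ (uncurry inner) (λ { (inner e a) → e , a }) (Adj? H u v ×-dec Arc? D _ _)
    RArc? (inj₁ u) (inj₂ x) =
      map′ (λ (arc , c , e , arc′) → outer c arc e arc′)
           (λ { (outer c arc e arc′) → arc , c , e , arc′ })
           (Arc? D (embed (inj₁ u)) (embed (inj₂ x))
             ×-dec any? (λ c → Adj? H u c ×-dec Arc? D (embed (inj₁ c)) (embed (inj₂ x))))
    RArc? (inj₂ x) _ = no (λ ())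

    RArc⇒arc : ∀ {a b} → RArc a b → Arc D (embed a) (embed b)
    RArc⇒arc (inner _ arc)     = arc
    RArc⇒arc (outer _ arc _ _) = arc

    -- The ends of an edge of H have no common out-neighbour in V(G): by
    -- `edge-closed` it would be one of the ends themselves, a loop.
    common-is-extra : ∀ {u v w} → Adj H u v
      → Arc D (embed (inj₁ u)) w → Arc D (embed (inj₁ v)) w
      → ∃[ x ] (Arc D (embed (inj₁ u)) (embed (inj₂ x)) × Arc D (embed (inj₁ v)) (embed (inj₂ x)))
    common-is-extra {u} {v} {w} e a b
      rewrite sym (join-splitAt n k w) with splitAt n w
    ... | inj₂ x = x , a , b
    ... | inj₁ g with edge-closed e (λ _ → arc⇒adj a) (λ _ → arc⇒adj b)
    ...   | inj₁ refl = contradiction refl (arc-irrefl a)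
    ...   | inj₂ refl = contradiction refl (arc-irrefl b)

    open Glued RArc RArc?

    adj⇒PAdjR : ∀ u v → Adj H u v → PAdjR u v
    adj⇒PAdjR u v e =
      (λ { refl → Adj-irrefl H e }) , via-RArc (proj₂ (adj⇒padj (proj₂ subgraph u v e)))
      where
      -- Arcs between φu and φv become inner arcs; a common out-neighbour is
      -- extra by `common-is-extra`, and then both outer arcs exist.
      via-RArc : Linked (Arc D) (embed (inj₁ u)) (embed (inj₁ v)) → Linked RArc (inj₁ u) (inj₁ v)
      via-RArc (inj₁ a)                 = inj₁ (inner e a)
      via-RArc (inj₂ (inj₁ a))          = inj₂ (inj₁ (inner (Adj-sym H e) a))
      via-RArc (inj₂ (inj₂ (w , a , b))) with common-is-extra e a b
      ... | x , a′ , b′ = inj₂ (inj₂ (inj₂ x , outer v a′ e b′ , outer u b′ (Adj-sym H e) a′))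

    -- A common out-neighbour of u ≠ v in the new digraph forces u ~ v in H:
    -- it comes with an edge uz or ua of H, and otherwise φv would be adjacent
    -- to both of its ends, contradicting `edge-closed-H`.
    PAdjR⇒adj : ∀ u v → PAdjR u v → Adj H u v
    PAdjR⇒adj u v (_ , inj₁ (inner e _))         = e
    PAdjR⇒adj u v (_ , inj₂ (inj₁ (inner e _)))  = Adj-sym H e
    PAdjR⇒adj u v (u≢v , inj₂ (inj₂ (inj₁ z , inner e a , inner f b)))
      with edge-closed-H e (λ φu≢φv → common⇒adj φu≢φv a b) (λ _ → Adj-sym G (arc⇒adj b))
    ... | inj₁ refl = contradiction refl u≢v
    ... | inj₂ refl = contradiction f (Adj-irrefl H)
    PAdjR⇒adj u v (u≢v , inj₂ (inj₂ (inj₂ x , outer c a e b , outer _ a′ _ _))) with v ≟ c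
    ... | yes refl = e
    ... | no v≢c with edge-closed-H e (λ φu≢φv → common⇒adj φu≢φv a a′) (λ φc≢φv → common⇒adj φc≢φv b a′)
    ...   | inj₁ refl = contradiction refl u≢v
    ...   | inj₂ refl = contradiction refl v≢c

    restricted-phylogeny : HasPhylogenyDigraph H k
    restricted-phylogeny = glued ,
      glued-phylogeny H D embed RArc⇒arc (proj₁ phylogeny) adj⇒PAdjR PAdjR⇒adj (λ _ _ ())

corollary1 : ∀ {n m} (G : Graph n) (H : Graph m) (φ : Fin m → Fin n)
    → IsSubgraphVia H G φ
    → TriangleFree H
    → (∀ (S : Pred (Fin m) 0ℓ) → IsMaximalClique H S → IsMaximalClique G (image φ S))
    → PhyloNumberGE G H
corollary1 G H φ subgraph triangle-free maximal-preserved k (D , phylogeny) =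
  k , ≤-refl , restricted-phylogeny D phylogeny
  where open Restriction G H φ subgraph triangle-free maximal-preserved
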